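{- Let $C_n$ be a cycle on $n\ge 5$ vertices. Then the sparing number of the square of $C_n$ is \[\varphi(C_n^2)=\begin{cases}\frac{2}{3}n & \text{if } n\equiv 0 \pmod 3,\\ \frac{2}{3}(n+2) & \text{if } n\equiv 1 \pmod 3,\\ \frac{2}{3}(n+4) & \text{if } n\equiv 2 \pmod 3.\end{cases}\]
   Context: All graphs are simple and finite. $\mathbb{N}_0$ denotes the set of non-negative integers. For non-empty $A,B\subseteq\mathbb{N}_0$, $A+B=\{a+b: a\in A, b\in B\}$. An integer additive set-indexer (IASI) of a graph $G$ is an injective function $f:V(G)\to\mathcal{P}(\mathbb{N}_0)$ with non-empty values such that the induced map $f^+(uv)=f(u)+f(v)$ on $E(G)$ is also injective. An IASI is weak if $|f^+(uv)|=\max(|f(u)|,|f(v)|)$ for every edge $uv$. An element (vertex or edge) is mono-indexed if its set-label has cardinality $1$. The sparing number $\varphi(H)$ of a graph $H$ is the minimum number of mono-indexed edges over all weak IASIs of $H$. The square $G^2$ of $G$ has vertex set $V(G)$, two distinct vertices adjacent iff their distance in $G$ is at most $2$. -}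

module Defs where

open import Data.Nat using (ℕ; zero; suc; _+_; _*_; _∸_; _≤_; _<?_; _≡ᵇ_; ∣_-_∣; _⊔_; _⊓_)
import Data.Nat.Properties as ℕP
open import Data.Fin using (Fin; toℕ)
import Data.Fin.Properties as FinP
open import Data.List using (List; []; _∷_; length; map; concatMap; deduplicate; filterᵇ; cartesianProduct; allFin)
open import Data.List.Membership.Propositional using (_∈_)
open import Data.Product using (Σ; ∃; ∃-syntax; _×_; _,_; proj₁; proj₂)
open import Data.Sum using (_⊎_)
open import Data.Bool using (Bool; _∧_)
open import Function.Bundles using (_⇔_)
open import Relation.Binary.PropositionalEquality using (_≡_; _≢_)
open import Relation.Nullary using (Dec; ¬_; ¬?; ⌊_⌋)
open import Relation.Nullary.Decidable using (_×-dec_; _⊎-dec_)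
open import Relation.Binary using (Decidable)

-- Finite non-empty subsets of ℕ₀, represented by lists (duplicates and
-- order irrelevant; the represented set is the set of members).

FinSet : Set
FinSet = List ℕ

_≈ˢ_ : FinSet → FinSet → Set
A ≈ˢ B = ∀ x → (x ∈ A) ⇔ (x ∈ B)

_⊕_ : FinSet → FinSet → FinSet
A ⊕ B = concatMap (λ a → map (a +_) B) A

card : FinSet → ℕ
card A = length (deduplicate ℕP._≟_ A)

record Graph : Set₁ where
  field
    n    : ℕ
    Adj  : Fin n → Fin n → Set
    Adj? : Decidable Adj

open Graph public

-- Edges as unordered pairs {u,v} are enumerated once as (u , v) with u < v.
edges : (G : Graph) → List (Fin (n G) × Fin (n G))
edges G = filterᵇ (λ p → ⌊ Adj? G (proj₁ p) (proj₂ p) ⌋ ∧ ⌊ toℕ (proj₁ p) <? toℕ (proj₂ p) ⌋)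
                  (cartesianProduct (allFin (n G)) (allFin (n G)))

record IsIASI (G : Graph) (f : Fin (n G) → FinSet) : Set where
  field
    nonempty   : ∀ v → f v ≢ []
    injective  : ∀ u v → f u ≈ˢ f v → u ≡ v
    edgeInj    : ∀ u v u′ v′ → Adj G u v → Adj G u′ v′ →
                 (f u ⊕ f v) ≈ˢ (f u′ ⊕ f v′) →
                 (u ≡ u′ × v ≡ v′) ⊎ (u ≡ v′ × v ≡ u′)

record IsWeakIASI (G : Graph) (f : Fin (n G) → FinSet) : Set where
  field
    iasi : IsIASI G f
    weak : ∀ u v → Adj G u v → card (f u ⊕ f v) ≡ card (f u) ⊔ card (f v)

monoEdges : (G : Graph) → (Fin (n G) → FinSet) → ℕ
monoEdges G f = length (filterᵇ (λ p → card (f (proj₁ p) ⊕ f (proj₂ p)) ≡ᵇ 1) (edges G))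

IsSparingNumber : Graph → ℕ → Set
IsSparingNumber G k =
  (Σ (Fin (n G) → FinSet) λ f → IsWeakIASI G f × monoEdges G f ≡ k)
  × (∀ f → IsWeakIASI G f → k ≤ monoEdges G f)

cycDist : (m : ℕ) → Fin m → Fin m → ℕ
cycDist m i j = ∣ toℕ i - toℕ j ∣ ⊓ (m ∸ ∣ toℕ i - toℕ j ∣)

-- C_n on vertices 0..n-1, i ~ j iff j ≡ i ± 1 (mod n)   (n ≥ 3)
Cycle : ℕ → Graph
Cycle m = record
  { n = m
  ; Adj = λ i j → cycDist m i j ≡ 1
  ; Adj? = λ i j → cycDist m i j ℕP.≟ 1
  }

Square : Graph → Graph
Square G = record
  { n = n G
  ; Adj = λ u v → u ≢ v × (Adj G u v ⊎ ∃[ w ] (Adj G u w × Adj G w v))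
  ; Adj? = λ u v → ¬? (u FinP.≟ v) ×-dec
                   (Adj? G u v ⊎-dec FinP.any? (λ w → Adj? G u w ×-dec Adj? G w v))
  }

-- The sparing number of the square of the cycle C_N (N ≥ 5) is
-- 2N − 4⌊N/3⌋; according to N mod 3 this is the closed form of the theorem.
--
-- For finite non-empty A, B ⊆ ℕ with |B| ≥ 2 the sumset has
-- |A + B| > |A|.  Hence in a weak IASI an edge is mono-indexed iff both of
-- its ends are, and no edge joins two non-mono vertices.  In a d-regular
-- graph this yields  (mono-indexed edges) + d·K = |E|,  K the number of
-- non-mono vertices, and the handshake lemma gives |E| = 2N for the
-- 4-regular graph C_N².  The non-mono vertices are independent in C_N², so
-- their closed neighbourhoods in C_N (three vertices each) are disjoint and
-- 3K ≤ N.  Upper bound: labelling u by {2^u, 2^u + 1} for u = 0, 3, …,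
-- 3(⌊N/3⌋ − 1) and by {2^u} otherwise is a weak IASI with K = ⌊N/3⌋.

module Submission where

open import Defs
open import Data.Nat
  using (ℕ; zero; suc; _+_; _*_; _^_; _/_; _%_; _∸_; _≤_; _<_; _⊔_; _⊓_; ∣_-_∣; z≤n; s≤s; _<?_; _≤?_; _<ᵇ_)
open import Data.Nat.Properties
open import Data.Bool using (Bool; true; false; _∧_; T)
open import Data.Fin using (Fin; toℕ; fromℕ; fromℕ<) renaming (zero to fzero; suc to fsuc)
import Data.Fin.Properties as Fin
open import Data.Fin.Properties using (toℕ<n; toℕ-injective; toℕ-fromℕ<; toℕ-fromℕ)
open import Data.List using (List; []; _∷_; _++_; length; map; deduplicate; filterᵇ; tabulate; cartesianProduct; allFin)
open import Data.List.Properties using (length-map)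
open import Data.List.Extrema.Nat using (max; ⊥≤max; xs≤max; argmax-sel)
open import Data.List.Membership.Propositional using (_∈_)
open import Data.List.Membership.Propositional.Properties
  using (∈-map⁺; ∈-map⁻; ∈-concat⁺′; ∈-concat⁻′; ∈-deduplicate⁻; ∈-deduplicate⁺)
open import Data.List.Relation.Binary.Subset.Propositional using (_⊆_)
open import Data.List.Relation.Unary.Any using (here; there)
open import Data.List.Relation.Unary.All as All using ([]; _∷_)
open import Data.List.Relation.Unary.AllPairs using ([]; _∷_)
open import Data.List.Relation.Unary.Unique.Propositional using (Unique)
import Data.List.Relation.Unary.Unique.Propositional.Properties as Unique
open import Data.List.Relation.Unary.Unique.DecPropositional.Properties _≟_ using (deduplicate-!)
open import Data.Product using (Σ-syntax; ∃-syntax; _×_; _,_; proj₁; proj₂; swap)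
open import Data.Sum using (_⊎_; inj₁; inj₂)
open import Data.Empty using (⊥; ⊥-elim)
open import Function.Bundles using (Equivalence)
open import Relation.Nullary using (¬_; ¬?; Dec; does; yes; no; ⌊_⌋)
open import Relation.Unary using (Decidable)
open import Function using (_∘_)
open import Data.Nat.DivMod using (m≡m%n+[m/n]*n; m*n/n≡m; m/n*n≤m; /-monoˡ-≤)
open import Data.Nat.Solver using (module +-*-Solver)
open +-*-Solver using (solve; _:+_; _:*_; _:=_; con)
open import Algebra.Properties.Semiring.Sum +-*-semiring
  using (sum-syntax; ∑-distrib-+; ∑-comm; sum-cong-≗; *-distribʳ-sum; *-distribˡ-sum)
open import Relation.Binary.PropositionalEquality
open import Relation.Binary.Definitions using (tri<; tri≈; tri>)

removeOne : ∀ {x : ℕ} {ys} → x ∈ ys →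
            ∃[ ys′ ] length ys ≡ suc (length ys′) × (∀ {z} → z ∈ ys → z ≢ x → z ∈ ys′)
removeOne {ys = y ∷ ys} (here refl) = ys , refl , λ { (here z≡y) z≢y → ⊥-elim (z≢y z≡y) ; (there z∈) _ → z∈ }
removeOne {ys = y ∷ ys} (there x∈) with removeOne x∈
... | ys′ , len , keep =
  y ∷ ys′ , cong suc len , λ { (here z≡y) _ → here z≡y ; (there z∈) z≢x → there (keep z∈ z≢x) }

unique⊆⇒length≤ : ∀ {xs ys : List ℕ} → Unique xs → xs ⊆ ys → length xs ≤ length ys
unique⊆⇒length≤ {[]} _ _ = z≤n
unique⊆⇒length≤ {x ∷ xs} (x∉xs ∷ uxs) xs⊆ys with removeOne (xs⊆ys (here refl))
... | ys′ , len , keep = subst (suc (length xs) ≤_) (sym len)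
  (s≤s (unique⊆⇒length≤ uxs (λ z∈ → keep (xs⊆ys (there z∈)) (λ z≡x → All.lookup x∉xs z∈ (sym z≡x)))))

unique⊆⇒≤card : ∀ {M L} → Unique M → M ⊆ L → length M ≤ card L
unique⊆⇒≤card u M⊆L = unique⊆⇒length≤ u (λ z∈ → ∈-deduplicate⁺ _≟_ (M⊆L z∈))

card-mono : ∀ {A B} → A ⊆ B → card A ≤ card B
card-mono {A} A⊆B = unique⊆⇒≤card (deduplicate-! A) (λ z∈ → A⊆B (∈-deduplicate⁻ _≟_ A z∈))

card-pos : ∀ {A} → A ≢ [] → 1 ≤ card A
card-pos {[]} A≢[] = ⊥-elim (A≢[] refl)
card-pos {x ∷ A} _ = s≤s z≤n

distinct⇒card≥2 : ∀ {A x y} → x ∈ A → y ∈ A → x ≢ y → 2 ≤ card A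
distinct⇒card≥2 x∈ y∈ x≢y =
  unique⊆⇒≤card ((x≢y ∷ []) ∷ [] ∷ []) λ { (here refl) → x∈ ; (there (here refl)) → y∈ }

card≥2⇒distinct : ∀ A → 2 ≤ card A → ∃[ x ] ∃[ y ] x ∈ A × y ∈ A × x ≢ y
card≥2⇒distinct A 2≤ with deduplicate _≟_ A | deduplicate-! A | ∈-deduplicate⁻ _≟_ A
... | x ∷ y ∷ _ | (x∉ ∷ _) | ⊆A = x , y , ⊆A (here refl) , ⊆A (there (here refl)) , All.head x∉
card≥2⇒distinct A (s≤s ()) | x ∷ [] | _ | _

card≤1 : ∀ {A} x → (∀ {z} → z ∈ A → z ≡ x) → card A ≤ 1
card≤1 {A} x all≡x = card-mono {B = x ∷ []} (λ z∈ → here (all≡x z∈))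

card≡1⇒all≡ : ∀ {A x y} → card A ≡ 1 → x ∈ A → y ∈ A → x ≡ y
card≡1⇒all≡ {x = x} {y} c x∈ y∈ with x ≟ y
... | yes x≡y = x≡y
... | no x≢y = ⊥-elim (1+n≰n (subst (2 ≤_) c (distinct⇒card≥2 x∈ y∈ x≢y)))

card≢1⇒card≥2 : ∀ {A} → A ≢ [] → card A ≢ 1 → 2 ≤ card A
card≢1⇒card≥2 {A} A≢[] c≢1 with card A | card-pos A≢[]
... | suc zero | _ = ⊥-elim (c≢1 refl)
... | suc (suc _) | _ = s≤s (s≤s z≤n)

largest : ∀ {A} → A ≢ [] → ∃[ m ] m ∈ A × (∀ {a} → a ∈ A → a ≤ m)
largest {[]} A≢[] = ⊥-elim (A≢[] refl)
largest {a ∷ A} _ = max a A , max∈ , bound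
  where
  max∈ : max a A ∈ a ∷ A
  max∈ with argmax-sel (λ x → x) a A
  ... | inj₁ max≡a = here max≡a
  ... | inj₂ max∈A = there max∈A
  bound : ∀ {x} → x ∈ a ∷ A → x ≤ max a A
  bound (here refl) = ⊥≤max a A
  bound (there x∈A) = All.lookup (xs≤max a A) x∈A

⊕⁺ : ∀ {A B a b} → a ∈ A → b ∈ B → a + b ∈ A ⊕ B
⊕⁺ {A} {B} {a} a∈ b∈ = ∈-concat⁺′ (∈-map⁺ (a +_) b∈) (∈-map⁺ (λ x → map (x +_) B) a∈)

⊕⁻ : ∀ {A B z} → z ∈ A ⊕ B → ∃[ a ] ∃[ b ] a ∈ A × b ∈ B × z ≡ a + b
⊕⁻ {A} {B} z∈ with ∈-concat⁻′ (map (λ x → map (x +_) B) A) z∈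
... | xs , z∈xs , xs∈ with ∈-map⁻ (λ x → map (x +_) B) xs∈
... | a , a∈ , refl with ∈-map⁻ (a +_) z∈xs
... | b , b∈ , refl = a , b , a∈ , b∈ , refl

⊕-nonempty : ∀ {A B} → A ≢ [] → B ≢ [] → A ⊕ B ≢ []
⊕-nonempty {[]} A≢[] _ = ⊥-elim (A≢[] refl)
⊕-nonempty {_ ∷ _} {[]} _ B≢[] = ⊥-elim (B≢[] refl)
⊕-nonempty {_ ∷ _} {_ ∷ _} _ _ = λ ()

⊕-comm⊆ : ∀ A B → A ⊕ B ⊆ B ⊕ A
⊕-comm⊆ A B z∈ with ⊕⁻ {A} {B} z∈
... | a , b , a∈ , b∈ , refl = subst (_∈ B ⊕ A) (+-comm b a) (⊕⁺ b∈ a∈)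

card-⊕-comm : ∀ A B → card (A ⊕ B) ≡ card (B ⊕ A)
card-⊕-comm A B = ≤-antisym (card-mono (⊕-comm⊆ A B)) (card-mono (⊕-comm⊆ B A))

-- Adding a set containing b₁ < b₂ strictly enlarges a non-empty set A: the
-- translates a + b₁ (a ∈ A) are card A distinct sums, and max A + b₂ exceeds
-- all of them.
card-⊕-grows-by : ∀ {A B b₁ b₂} → A ≢ [] → b₁ ∈ B → b₂ ∈ B → b₁ < b₂ →
                  suc (card A) ≤ card (A ⊕ B)
card-⊕-grows-by {A} {B} {b₁} {b₂} A≢[] b₁∈ b₂∈ b₁<b₂ with largest A≢[]
... | m , m∈ , ≤m = subst (_≤ card (A ⊕ B)) (cong suc (length-map (_+ b₁) A′))
      (unique⊆⇒≤card (All.tabulate top-new ∷ Unique.map⁺ (+-cancelʳ-≡ b₁ _ _) (deduplicate-! A)) sums⊆)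
  where
  A′ = deduplicate _≟_ A
  top-new : ∀ {z} → z ∈ map (_+ b₁) A′ → m + b₂ ≢ z
  top-new z∈ eq with ∈-map⁻ (_+ b₁) z∈
  ... | a , a∈ , refl = <-irrefl (sym eq) (+-mono-≤-< (≤m (∈-deduplicate⁻ _≟_ A a∈)) b₁<b₂)
  sums⊆ : m + b₂ ∷ map (_+ b₁) A′ ⊆ A ⊕ B
  sums⊆ (here refl) = ⊕⁺ m∈ b₂∈
  sums⊆ (there z∈) with ∈-map⁻ (_+ b₁) z∈
  ... | a , a∈ , refl = ⊕⁺ (∈-deduplicate⁻ _≟_ A a∈) b₁∈

card-⊕-grows : ∀ {A B} → A ≢ [] → 2 ≤ card B → suc (card A) ≤ card (A ⊕ B)
card-⊕-grows {A} {B} A≢[] 2≤B with card≥2⇒distinct B 2≤B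
... | x , y , x∈ , y∈ , x≢y with <-cmp x y
... | tri< x<y _ _ = card-⊕-grows-by A≢[] x∈ y∈ x<y
... | tri≈ _ x≡y _ = ⊥-elim (x≢y x≡y)
... | tri> _ _ y<x = card-⊕-grows-by A≢[] y∈ x∈ y<x

mono-⊕ : ∀ {A B} → A ≢ [] → B ≢ [] → card A ≡ 1 → card B ≡ 1 → card (A ⊕ B) ≡ 1
mono-⊕ {[]} A≢[] _ _ _ = ⊥-elim (A≢[] refl)
mono-⊕ {_ ∷ _} {[]} _ B≢[] _ _ = ⊥-elim (B≢[] refl)
mono-⊕ {a ∷ A} {b ∷ B} A≢[] B≢[] cA cB =
  ≤-antisym (card≤1 (a + b) all≡) (card-pos (⊕-nonempty A≢[] B≢[]))
  where
  all≡ : ∀ {z} → z ∈ (a ∷ A) ⊕ (b ∷ B) → z ≡ a + b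
  all≡ z∈ with ⊕⁻ {a ∷ A} {b ∷ B} z∈
  ... | x , y , x∈ , y∈ , refl = cong₂ _+_ (card≡1⇒all≡ cA x∈ (here refl)) (card≡1⇒all≡ cB y∈ (here refl))

-- conversely a singleton sum has singleton summands, since otherwise the sum
-- would be larger than the non-empty other summand
mono-⊕⁻ʳ : ∀ {A B} → A ≢ [] → B ≢ [] → card (A ⊕ B) ≡ 1 → card B ≡ 1
mono-⊕⁻ʳ {A} {B} A≢[] B≢[] c with card B ≟ 1
... | yes cB = cB
... | no cB≢1 = ⊥-elim (1+n≰n (≤-trans (s≤s (card-pos A≢[]))
                  (subst (suc (card A) ≤_) c (card-⊕-grows A≢[] (card≢1⇒card≥2 B≢[] cB≢1)))))

mono-⊕⁻ˡ : ∀ {A B} → A ≢ [] → B ≢ [] → card (A ⊕ B) ≡ 1 → card A ≡ 1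
mono-⊕⁻ˡ {A} {B} A≢[] B≢[] c = mono-⊕⁻ʳ B≢[] A≢[] (trans (card-⊕-comm B A) c)

weak⇒some-mono : ∀ {A B} → A ≢ [] → B ≢ [] → card (A ⊕ B) ≡ card A ⊔ card B →
                 card A ≢ 1 → card B ≢ 1 → ⊥
weak⇒some-mono {A} {B} A≢[] B≢[] weak cA≢1 cB≢1 with ⊔-sel (card A) (card B)
... | inj₁ ⊔≡A = <-irrefl (sym (trans weak ⊔≡A)) (card-⊕-grows A≢[] (card≢1⇒card≥2 B≢[] cB≢1))
... | inj₂ ⊔≡B = <-irrefl (sym (trans (trans (card-⊕-comm B A) weak) ⊔≡B))
                           (card-⊕-grows B≢[] (card≢1⇒card≥2 A≢[] cA≢1))

ind : Bool → ℕ
ind true = 1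
ind false = 0

χ : ∀ {P : Set} → Dec P → ℕ
χ d = ind (does d)

ind-⌊⌋ : ∀ {P : Set} (d : Dec P) → ind ⌊ d ⌋ ≡ χ d
ind-⌊⌋ (yes _) = refl
ind-⌊⌋ (no _) = refl

ind-∧ : ∀ a b → ind (a ∧ b) ≡ ind a * ind b
ind-∧ true b = sym (+-identityʳ (ind b))
ind-∧ false b = refl

module _ {P : Set} where

  χ-yes : P → (d : Dec P) → χ d ≡ 1
  χ-yes p (yes _) = refl
  χ-yes p (no ¬p) = ⊥-elim (¬p p)

  χ-no : ¬ P → (d : Dec P) → χ d ≡ 0
  χ-no ¬p (yes p) = ⊥-elim (¬p p)
  χ-no ¬p (no _) = refl

  χ≤1 : (d : Dec P) → χ d ≤ 1
  χ≤1 (yes _) = s≤s z≤n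
  χ≤1 (no _) = z≤n

module _ {P Q : Set} where

  χ-cong : (P → Q) → (Q → P) → (d : Dec P) (e : Dec Q) → χ d ≡ χ e
  χ-cong to from (yes p) e = sym (χ-yes (to p) e)
  χ-cong to from (no ¬p) e = sym (χ-no (¬p ∘ from) e)

  χ-compl : (P → Q → ⊥) → (¬ P → Q) → (d : Dec P) (e : Dec Q) → χ d + χ e ≡ 1
  χ-compl excl _ (yes p) e = cong suc (χ-no (excl p) e)
  χ-compl _ cover (no ¬p) e = χ-yes (cover ¬p) e

  χ-⊎ : ∀ {R : Set} → (R → P ⊎ Q) → (P → R) → (Q → R) → (P → Q → ⊥) →
        (r : Dec R) (d : Dec P) (e : Dec Q) → χ r ≡ χ d + χ e
  χ-⊎ split inl inr excl (yes r) (yes p) (yes q) = ⊥-elim (excl p q)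
  χ-⊎ split inl inr excl (yes r) (yes p) (no _) = refl
  χ-⊎ split inl inr excl (yes r) (no _) (yes q) = refl
  χ-⊎ split inl inr excl (yes r) (no ¬p) (no ¬q) with split r
  ... | inj₁ p = ⊥-elim (¬p p)
  ... | inj₂ q = ⊥-elim (¬q q)
  χ-⊎ split inl inr excl (no ¬r) (yes p) _ = ⊥-elim (¬r (inl p))
  χ-⊎ split inl inr excl (no ¬r) (no _) (yes q) = ⊥-elim (¬r (inr q))
  χ-⊎ split inl inr excl (no ¬r) (no _) (no _) = refl

-- Elementary finite sums over Fin n (∑ from the standard library's semiring
-- sums; note that ∑[ i < n ] binds more tightly than _*_ and _+_).
∑-zero : ∀ n → ∑[ i < n ] 0 ≡ 0
∑-zero zero = refl
∑-zero (suc n) = ∑-zero n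

∑-ones : ∀ n → ∑[ i < n ] 1 ≡ n
∑-ones zero = refl
∑-ones (suc n) = cong suc (∑-ones n)

∑-mono : ∀ n {g h : Fin n → ℕ} → (∀ i → g i ≤ h i) → ∑[ i < n ] g i ≤ ∑[ i < n ] h i
∑-mono zero _ = z≤n
∑-mono (suc n) g≤h = +-mono-≤ (g≤h fzero) (∑-mono n (g≤h ∘ fsuc))

∑-δ : ∀ {n} (j : Fin n) → ∑[ i < n ] χ (j Fin.≟ i) ≡ 1
∑-δ {suc n} fzero = cong suc (∑-zero n)
∑-δ {suc n} (fsuc j) = ∑-δ j

∑-atMostOne : ∀ n (g : Fin n → ℕ) → (∀ i → g i ≤ 1) →
              (∀ i j → 1 ≤ g i → 1 ≤ g j → i ≡ j) → ∑[ i < n ] g i ≤ 1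
∑-atMostOne zero g _ _ = z≤n
∑-atMostOne (suc n) g g≤1 unique with g fzero in g₀≡
... | zero = ∑-atMostOne n (g ∘ fsuc) (g≤1 ∘ fsuc)
               (λ i j gi gj → Fin.suc-injective (unique (fsuc i) (fsuc j) gi gj))
... | suc x = ≤-trans (≤-reflexive (trans (cong (suc x +_) rest-zero) (+-identityʳ (suc x))))
                      (subst (_≤ 1) g₀≡ (g≤1 fzero))
  where
  rest-zero : ∑[ i < n ] g (fsuc i) ≡ 0
  rest-zero = trans (sum-cong-≗ {n} rest) (∑-zero n)
    where
    rest : ∀ i → g (fsuc i) ≡ 0
    rest i with g (fsuc i) in gᵢ≡
    ... | zero = refl
    ... | suc _ with unique (fsuc i) fzero (subst (1 ≤_) (sym gᵢ≡) (s≤s z≤n)) (subst (1 ≤_) (sym g₀≡) (s≤s z≤n))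
    ... | ()

count : ∀ {A : Set} → (A → Bool) → List A → ℕ
count p xs = length (filterᵇ p xs)

count-filter : ∀ {A : Set} (p q : A → Bool) xs → count p (filterᵇ q xs) ≡ count (λ x → q x ∧ p x) xs
count-filter p q [] = refl
count-filter p q (x ∷ xs) with q x
... | false = count-filter p q xs
... | true with p x
... | false = count-filter p q xs
... | true = cong suc (count-filter p q xs)

count-++ : ∀ {A : Set} (p : A → Bool) xs ys → count p (xs ++ ys) ≡ count p xs + count p ys
count-++ p [] ys = refl
count-++ p (x ∷ xs) ys with p x
... | false = count-++ p xs ys
... | true = cong suc (count-++ p xs ys)

count-tabulate : ∀ {A : Set} {n} (p : A → Bool) (g : Fin n → A) → count p (tabulate g) ≡ ∑[ i < n ] ind (p (g i))
count-tabulate {n = zero} p g = refl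
count-tabulate {n = suc n} p g with p (g fzero)
... | false = count-tabulate p (g ∘ fsuc)
... | true = cong suc (count-tabulate p (g ∘ fsuc))

count-map : ∀ {A B : Set} (p : B → Bool) (h : A → B) xs → count p (map h xs) ≡ count (p ∘ h) xs
count-map p h [] = refl
count-map p h (x ∷ xs) with p (h x)
... | false = count-map p h xs
... | true = cong suc (count-map p h xs)

count-product : ∀ {A B : Set} {n} (p : A × B → Bool) (g : Fin n → A) ys →
                count p (cartesianProduct (tabulate g) ys) ≡ ∑[ i < n ] count (λ y → p (g i , y)) ys
count-product {n = zero} p g ys = refl
count-product {n = suc n} p g ys = trans (count-++ p (map (g fzero ,_) ys) _)
  (cong₂ _+_ (count-map p (g fzero ,_) ys) (count-product p (g ∘ fsuc) ys))

count-grid : ∀ n (p : Fin n × Fin n → Bool) →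
             count p (cartesianProduct (allFin n) (allFin n)) ≡ ∑[ u < n ] ∑[ v < n ] ind (p (u , v))
count-grid n p = trans (count-product p (λ u → u) (allFin n))
                       (sum-cong-≗ {n} λ u → count-tabulate (λ v → p (u , v)) (λ v → v))

∑∑-distrib-+ : ∀ n (f g : Fin n → Fin n → ℕ) →
               ∑[ u < n ] ∑[ v < n ] (f u v + g u v) ≡ ∑[ u < n ] ∑[ v < n ] f u v + ∑[ u < n ] ∑[ v < n ] g u v
∑∑-distrib-+ n f g = trans (sum-cong-≗ {n} (λ u → ∑-distrib-+ (f u) (g u)))
                           (∑-distrib-+ (λ u → ∑[ v < n ] f u v) (λ u → ∑[ v < n ] g u v))

∑∑-cong : ∀ n {f g : Fin n → Fin n → ℕ} → (∀ u v → f u v ≡ g u v) →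
          ∑[ u < n ] ∑[ v < n ] f u v ≡ ∑[ u < n ] ∑[ v < n ] g u v
∑∑-cong n f≡g = sum-cong-≗ {n} (λ u → sum-cong-≗ {n} (f≡g u))

module _ (G : Graph) where

  adjχ : Fin (n G) → Fin (n G) → ℕ
  adjχ u v = χ (Adj? G u v)

  edgeχ : Fin (n G) → Fin (n G) → ℕ
  edgeχ u v = adjχ u v * χ (toℕ u <? toℕ v)

  edgeCount : ℕ
  edgeCount = ∑[ u < n G ] ∑[ v < n G ] edgeχ u v

  Symmetric : Set
  Symmetric = ∀ u v → Adj G u v → Adj G v u

  Loopless : Set
  Loopless = ∀ u v → Adj G u v → u ≢ v

  Regular : ℕ → Set
  Regular d = ∀ u → ∑[ v < n G ] adjχ u v ≡ d

  count-edges : ∀ (p : Fin (n G) × Fin (n G) → Bool) →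
                count p (edges G) ≡ ∑[ u < n G ] ∑[ v < n G ] (edgeχ u v * ind (p (u , v)))
  count-edges p = begin
    count p (edges G)
      ≡⟨ count-filter p isEdge (cartesianProduct (allFin (n G)) (allFin (n G))) ⟩
    count (λ e → isEdge e ∧ p e) (cartesianProduct (allFin (n G)) (allFin (n G)))
      ≡⟨ count-grid (n G) _ ⟩
    ∑[ u < n G ] ∑[ v < n G ] ind (isEdge (u , v) ∧ p (u , v))
      ≡⟨ ∑∑-cong (n G) split ⟩
    ∑[ u < n G ] ∑[ v < n G ] (edgeχ u v * ind (p (u , v))) ∎
    where
    open ≡-Reasoning
    isEdge : Fin (n G) × Fin (n G) → Bool
    isEdge e = ⌊ Adj? G (proj₁ e) (proj₂ e) ⌋ ∧ ⌊ toℕ (proj₁ e) <? toℕ (proj₂ e) ⌋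
    split : ∀ u v → ind (isEdge (u , v) ∧ p (u , v)) ≡ edgeχ u v * ind (p (u , v))
    split u v = trans (ind-∧ (isEdge (u , v)) (p (u , v)))
                      (cong (_* ind (p (u , v))) (trans (ind-∧ ⌊ Adj? G u v ⌋ ⌊ toℕ u <? toℕ v ⌋)
                                                        (cong₂ _*_ (ind-⌊⌋ (Adj? G u v)) (ind-⌊⌋ (toℕ u <? toℕ v)))))

  edgeχ-orientations : Symmetric → Loopless → ∀ u v → edgeχ u v + edgeχ v u ≡ adjχ u v
  edgeχ-orientations symmetric loopless u v with Adj? G u v
  ... | no ¬uv = cong (λ a → a * χ (toℕ v <? toℕ u)) (χ-no (¬uv ∘ symmetric v u) (Adj? G v u))
  ... | yes uv = begin
    1 * χ (toℕ u <? toℕ v) + adjχ v u * χ (toℕ v <? toℕ u)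
      ≡⟨ cong (λ b → 1 * χ (toℕ u <? toℕ v) + b * χ (toℕ v <? toℕ u)) (χ-yes (symmetric u v uv) (Adj? G v u)) ⟩
    1 * χ (toℕ u <? toℕ v) + 1 * χ (toℕ v <? toℕ u)
      ≡⟨ cong₂ _+_ (*-identityˡ (χ (toℕ u <? toℕ v))) (*-identityˡ (χ (toℕ v <? toℕ u))) ⟩
    χ (toℕ u <? toℕ v) + χ (toℕ v <? toℕ u)
      ≡⟨ χ-compl <-asym (λ u≮v → ≤∧≢⇒< (≮⇒≥ u≮v) (loopless u v uv ∘ Fin.toℕ-injective ∘ sym))
                 (toℕ u <? toℕ v) (toℕ v <? toℕ u) ⟩
    1 ∎
    where open ≡-Reasoning


module _ (G : Graph) (symmetric : Symmetric G) (loopless : Loopless G)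
         {d : ℕ} (regular : Regular G d) where

  private
    N = n G
    X = edgeχ G

  -- Summing a vertex weight over both ends of every edge counts each vertex
  -- once per incident edge, i.e. d times.
  ∑-edge-ends : ∀ (w : Fin N → ℕ) →
    ∑[ u < N ] ∑[ v < N ] (X u v * (w u + w v)) ≡ d * ∑[ u < N ] w u
  ∑-edge-ends w = begin
    ∑[ u < N ] ∑[ v < N ] (X u v * (w u + w v))
      ≡⟨ ∑∑-cong N (λ u v → *-distribˡ-+ (X u v) (w u) (w v)) ⟩
    ∑[ u < N ] ∑[ v < N ] (X u v * w u + X u v * w v)
      ≡⟨ ∑∑-distrib-+ N (λ u v → X u v * w u) (λ u v → X u v * w v) ⟩
    ∑[ u < N ] ∑[ v < N ] (X u v * w u) + ∑[ u < N ] ∑[ v < N ] (X u v * w v)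
      ≡⟨ cong (∑[ u < N ] ∑[ v < N ] (X u v * w u) +_) (∑-comm (λ u v → X u v * w v)) ⟩
    ∑[ u < N ] ∑[ v < N ] (X u v * w u) + ∑[ u < N ] ∑[ v < N ] (X v u * w u)
      ≡⟨ sym (∑∑-distrib-+ N (λ u v → X u v * w u) (λ u v → X v u * w u)) ⟩
    ∑[ u < N ] ∑[ v < N ] (X u v * w u + X v u * w u)
      ≡⟨ ∑∑-cong N (λ u v → trans (sym (*-distribʳ-+ (w u) (X u v) (X v u)))
                                  (cong (_* w u) (edgeχ-orientations G symmetric loopless u v))) ⟩
    ∑[ u < N ] ∑[ v < N ] (adjχ G u v * w u)
      ≡⟨ sum-cong-≗ {N} (λ u → sym (*-distribʳ-sum (w u) (adjχ G u))) ⟩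
    ∑[ u < N ] (∑[ v < N ] adjχ G u v * w u)
      ≡⟨ sum-cong-≗ {N} (λ u → cong (_* w u) (regular u)) ⟩
    ∑[ u < N ] (d * w u)
      ≡⟨ sym (*-distribˡ-sum d w) ⟩
    d * ∑[ u < N ] w u ∎
    where open ≡-Reasoning

  handshake : 2 * edgeCount G ≡ d * N
  handshake = begin
    2 * edgeCount G                        ≡⟨ *-comm 2 (edgeCount G) ⟩
    edgeCount G * 2                        ≡⟨ *-distribʳ-sum 2 (λ u → ∑[ v < N ] X u v) ⟩
    ∑[ u < N ] (∑[ v < N ] X u v * 2)      ≡⟨ sum-cong-≗ {N} (λ u → *-distribʳ-sum 2 (X u)) ⟩
    ∑[ u < N ] ∑[ v < N ] (X u v * 2)      ≡⟨ ∑-edge-ends (λ _ → 1) ⟩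
    d * ∑[ u < N ] 1                       ≡⟨ cong (d *_) (∑-ones N) ⟩
    d * N                                  ∎
    where open ≡-Reasoning

nonMono? : ∀ {m} (f : Fin m → FinSet) u → Dec (card (f u) ≢ 1)
nonMono? f u = ¬? (card (f u) ≟ 1)

nonMonoCount : ∀ {m} → (Fin m → FinSet) → ℕ
nonMonoCount {m} f = ∑[ u < m ] χ (nonMono? f u)

module _ {G : Graph} {f : Fin (n G) → FinSet} (W : IsWeakIASI G f) where

  private
    nonempty : ∀ u → f u ≢ []
    nonempty = IsIASI.nonempty (IsWeakIASI.iasi W)

  -- In a weak IASI an edge is mono-indexed iff both ends are, and its two
  -- ends are never both non-mono; so exactly one of three things happens.
  edge-trichotomy : ∀ {u v} → Adj G u v →
    χ (card (f u ⊕ f v) ≟ 1) + (χ (nonMono? f u) + χ (nonMono? f v)) ≡ 1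
  edge-trichotomy {u} {v} uv = cases (card (f u) ≟ 1) (card (f v) ≟ 1)
    where
    cases : (du : Dec (card (f u) ≡ 1)) (dv : Dec (card (f v) ≡ 1)) →
            χ (card (f u ⊕ f v) ≟ 1) + (χ (¬? du) + χ (¬? dv)) ≡ 1
    cases (yes cu) (yes cv) = cong (_+ 0) (χ-yes (mono-⊕ (nonempty u) (nonempty v) cu cv) (card (f u ⊕ f v) ≟ 1))
    cases (yes cu) (no cv) = cong (_+ 1) (χ-no (cv ∘ mono-⊕⁻ʳ (nonempty u) (nonempty v)) (card (f u ⊕ f v) ≟ 1))
    cases (no cu) (yes cv) = cong (_+ 1) (χ-no (cu ∘ mono-⊕⁻ˡ (nonempty u) (nonempty v)) (card (f u ⊕ f v) ≟ 1))
    cases (no cu) (no cv) = ⊥-elim (weak⇒some-mono (nonempty u) (nonempty v) (IsWeakIASI.weak W u v uv) cu cv)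

  nonMono-independent : ∀ {u v} → card (f u) ≢ 1 → card (f v) ≢ 1 → ¬ Adj G u v
  nonMono-independent cu cv uv = weak⇒some-mono (nonempty _) (nonempty _) (IsWeakIASI.weak W _ _ uv) cu cv

-- In a weak IASI of a d-regular graph, every edge that is not mono-indexed
-- has exactly one non-mono end, and each non-mono vertex lies on d edges.
monoEdges+nonMono : ∀ (G : Graph) → Symmetric G → Loopless G → ∀ {d} → Regular G d →
  ∀ {f} → IsWeakIASI G f → monoEdges G f + d * nonMonoCount f ≡ edgeCount G
monoEdges+nonMono G symmetric loopless {d} regular {f} W = begin
  monoEdges G f + d * nonMonoCount f
    ≡⟨ cong₂ _+_ (count-edges G _) (sym (∑-edge-ends G symmetric loopless regular γ)) ⟩
  ∑[ u < N ] ∑[ v < N ] (X u v * m u v) + ∑[ u < N ] ∑[ v < N ] (X u v * (γ u + γ v))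
    ≡⟨ sym (∑∑-distrib-+ N (λ u v → X u v * m u v) (λ u v → X u v * (γ u + γ v))) ⟩
  ∑[ u < N ] ∑[ v < N ] (X u v * m u v + X u v * (γ u + γ v))
    ≡⟨ ∑∑-cong N (λ u v → trans (sym (*-distribˡ-+ (X u v) _ _)) (edge-weight u v (Adj? G u v))) ⟩
  edgeCount G ∎
  where
  open ≡-Reasoning
  N = n G
  X = edgeχ G
  γ : Fin N → ℕ
  γ u = χ (nonMono? f u)
  m : Fin N → Fin N → ℕ
  m u v = χ (card (f u ⊕ f v) ≟ 1)
  edge-weight : ∀ u v (a : Dec (Adj G u v)) →
                χ a * χ (toℕ u <? toℕ v) * (m u v + (γ u + γ v)) ≡ χ a * χ (toℕ u <? toℕ v)
  edge-weight u v (yes uv) = trans (cong (1 * χ (toℕ u <? toℕ v) *_) (edge-trichotomy W uv)) (*-identityʳ _)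
  edge-weight u v (no _) = refl

closedNbhd⇒square : ∀ (G : Graph) → Symmetric G → ∀ {u u′ v} →
  u ≡ v ⊎ Adj G u v → u′ ≡ v ⊎ Adj G u′ v → u ≢ u′ → Adj (Square G) u u′
closedNbhd⇒square G symmetric (inj₁ refl) (inj₁ refl) u≢u′ = ⊥-elim (u≢u′ refl)
closedNbhd⇒square G symmetric (inj₁ refl) (inj₂ u′v) u≢u′ = u≢u′ , inj₁ (symmetric _ _ u′v)
closedNbhd⇒square G symmetric (inj₂ uv) (inj₁ refl) u≢u′ = u≢u′ , inj₁ uv
closedNbhd⇒square G symmetric (inj₂ uv) (inj₂ u′v) u≢u′ = u≢u′ , inj₂ (_ , uv , symmetric _ _ u′v)

module _ {P Q R : Set} where

  χ*χ+χ≤1 : (P → Q → ⊥) → (d : Dec P) (e : Dec Q) (f : Dec R) → χ f * (χ d + χ e) ≤ 1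
  χ*χ+χ≤1 excl (yes p) (yes q) f = ⊥-elim (excl p q)
  χ*χ+χ≤1 excl (yes _) (no _) f = ≤-trans (≤-reflexive (*-identityʳ (χ f))) (χ≤1 f)
  χ*χ+χ≤1 excl (no _) e f = ≤-trans (*-monoʳ-≤ (χ f) (χ≤1 e)) (≤-trans (≤-reflexive (*-identityʳ (χ f))) (χ≤1 f))

  χ*χ+χ-pos : (d : Dec P) (e : Dec Q) (f : Dec R) → 1 ≤ χ f * (χ d + χ e) → R × (P ⊎ Q)
  χ*χ+χ-pos (yes p) e (yes r) _ = r , inj₁ p
  χ*χ+χ-pos (no _) (yes q) (yes r) _ = r , inj₂ q

-- Sphere packing in G²: if no two vertices of P are adjacent in G², the
-- closed G-neighbourhoods (of size r + 1) of the vertices of P are disjoint,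
-- so P has at most n / (r + 1) vertices.
packing : ∀ (G : Graph) → Symmetric G → Loopless G → ∀ {r} → Regular G r →
  ∀ {P : Fin (n G) → Set} (P? : Decidable P) → (∀ {u v} → P u → P v → ¬ Adj (Square G) u v) →
  (∑[ u < n G ] χ (P? u)) * suc r ≤ n G
packing G symmetric loopless {r} regular {P} P? independent = begin
  (∑[ u < N ] χ (P? u)) * suc r                    ≡⟨ *-distribʳ-sum (suc r) (λ u → χ (P? u)) ⟩
  ∑[ u < N ] (χ (P? u) * suc r)                    ≡⟨ sum-cong-≗ {N} (λ u → cong (χ (P? u) *_) (sym (ball-size u))) ⟩
  ∑[ u < N ] (χ (P? u) * ∑[ v < N ] ball u v)      ≡⟨ sum-cong-≗ {N} (λ u → *-distribˡ-sum (χ (P? u)) (ball u)) ⟩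
  ∑[ u < N ] ∑[ v < N ] (χ (P? u) * ball u v)      ≡⟨ ∑-comm (λ u v → χ (P? u) * ball u v) ⟩
  ∑[ v < N ] ∑[ u < N ] (χ (P? u) * ball u v)      ≤⟨ ∑-mono N (λ v → ∑-atMostOne N _ (term≤1 v) (at-most-one v)) ⟩
  ∑[ v < N ] 1                                     ≡⟨ ∑-ones N ⟩
  N ∎
  where
  open ≤-Reasoning
  N = n G
  ball : Fin N → Fin N → ℕ
  ball u v = χ (u Fin.≟ v) + adjχ G u v
  ball-size : ∀ u → ∑[ v < N ] ball u v ≡ suc r
  ball-size u = trans (∑-distrib-+ (λ v → χ (u Fin.≟ v)) (adjχ G u)) (cong₂ _+_ (∑-δ u) (regular u))
  term≤1 : ∀ v u → χ (P? u) * ball u v ≤ 1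
  term≤1 v u = χ*χ+χ≤1 (λ { refl uu → loopless u u uu refl }) (u Fin.≟ v) (Adj? G u v) (P? u)
  at-most-one : ∀ v u u′ → 1 ≤ χ (P? u) * ball u v → 1 ≤ χ (P? u′) * ball u′ v → u ≡ u′
  at-most-one v u u′ hu hu′ with u Fin.≟ u′
  ... | yes u≡u′ = u≡u′
  ... | no u≢u′ with χ*χ+χ-pos (u Fin.≟ v) (Adj? G u v) (P? u) hu
                   | χ*χ+χ-pos (u′ Fin.≟ v) (Adj? G u′ v) (P? u′) hu′
  ... | Pu , near | Pu′ , near′ = ⊥-elim (independent Pu Pu′ (closedNbhd⇒square G symmetric near near′ u≢u′))

∣-∣≡⇒ : ∀ a c t → ∣ a - c ∣ ≡ t → c ≡ a + t ⊎ c + t ≡ a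
∣-∣≡⇒ a c t eq with ≤-total a c
... | inj₁ a≤c = inj₁ (trans (sym (m+[n∸m]≡n a≤c)) (cong (a +_) (trans (sym (m≤n⇒∣m-n∣≡n∸m a≤c)) eq)))
... | inj₂ c≤a = inj₂ (trans (cong (c +_) (trans (sym eq) (m≤n⇒∣n-m∣≡n∸m c≤a))) (m+[n∸m]≡n c≤a))

∣-∣≡⇐ : ∀ a c t → c ≡ a + t ⊎ c + t ≡ a → ∣ a - c ∣ ≡ t
∣-∣≡⇐ a c t (inj₁ refl) = ∣m-m+n∣≡n a t
∣-∣≡⇐ a c t (inj₂ refl) = trans (∣-∣-comm (c + t) c) (∣m-m+n∣≡n c t)

above≢below : ∀ a c t → 1 ≤ t → c ≡ a + t → c + t ≡ a → ⊥
above≢below a c t 1≤t refl eq =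
  <-irrefl (sym (trans (sym (+-assoc a t t)) eq)) (m<m+n a (≤-trans 1≤t (m≤m+n t t)))

∑-point : ∀ n e → ∑[ i < n ] χ (toℕ i ≟ e) ≡ χ (e <? n)
∑-point zero e = refl
∑-point (suc n) zero = cong suc (∑-zero n)
∑-point (suc n) (suc e) = ∑-point n e

∑-below : ∀ n a t → a < n → ∑[ i < n ] χ (toℕ i + t ≟ a) ≡ χ (t ≤? a)
∑-below n a t a<n = by-cases (t ≤? a)
  where
  open ≡-Reasoning
  by-cases : (t≤?a : Dec (t ≤ a)) → ∑[ i < n ] χ (toℕ i + t ≟ a) ≡ χ t≤?a
  by-cases (yes t≤a) = begin
    ∑[ i < n ] χ (toℕ i + t ≟ a)
      ≡⟨ sum-cong-≗ {n} (λ i → χ-cong (shift i) (unshift i) (toℕ i + t ≟ a) (toℕ i ≟ a ∸ t)) ⟩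
    ∑[ i < n ] χ (toℕ i ≟ a ∸ t)   ≡⟨ ∑-point n (a ∸ t) ⟩
    χ (a ∸ t <? n)                 ≡⟨ χ-yes (≤-<-trans (m∸n≤m a t) a<n) (a ∸ t <? n) ⟩
    1 ∎
    where
    shift : ∀ i → toℕ i + t ≡ a → toℕ i ≡ a ∸ t
    shift i eq = trans (sym (m+n∸n≡m (toℕ i) t)) (cong (_∸ t) eq)
    unshift : ∀ i → toℕ i ≡ a ∸ t → toℕ i + t ≡ a
    unshift i eq = trans (cong (_+ t) eq) (m∸n+n≡m t≤a)
  by-cases (no t≰a) = trans (sum-cong-≗ {n} λ i → χ-no (too-low i) (toℕ i + t ≟ a)) (∑-zero n)
    where
    too-low : ∀ i → toℕ i + t ≢ a
    too-low i eq = t≰a (subst (t ≤_) eq (m≤n+m t (toℕ i)))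

∑-distance : ∀ n a t → 1 ≤ t → a < n →
  ∑[ i < n ] χ (∣ a - toℕ i ∣ ≟ t) ≡ χ (a + t <? n) + χ (t ≤? a)
∑-distance n a t 1≤t a<n = begin
  ∑[ i < n ] χ (∣ a - toℕ i ∣ ≟ t)
    ≡⟨ sum-cong-≗ {n} (λ i → χ-⊎ (∣-∣≡⇒ a (toℕ i) t) (∣-∣≡⇐ a (toℕ i) t ∘ inj₁) (∣-∣≡⇐ a (toℕ i) t ∘ inj₂)
                                 (above≢below a (toℕ i) t 1≤t)
                                 (∣ a - toℕ i ∣ ≟ t) (toℕ i ≟ a + t) (toℕ i + t ≟ a)) ⟩
  ∑[ i < n ] (χ (toℕ i ≟ a + t) + χ (toℕ i + t ≟ a))
    ≡⟨ ∑-distrib-+ {n} (λ i → χ (toℕ i ≟ a + t)) (λ i → χ (toℕ i + t ≟ a)) ⟩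
  ∑[ i < n ] χ (toℕ i ≟ a + t) + ∑[ i < n ] χ (toℕ i + t ≟ a)
    ≡⟨ cong₂ _+_ (∑-point n (a + t)) (∑-below n a t a<n) ⟩
  χ (a + t <? n) + χ (t ≤? a) ∎
  where open ≡-Reasoning

module CyclicDistance (N : ℕ) where

  cd : ℕ → ℕ → ℕ
  cd a c = ∣ a - c ∣ ⊓ (N ∸ ∣ a - c ∣)

  ∣-∣<N : ∀ {a c} → a < N → c < N → ∣ a - c ∣ < N
  ∣-∣<N {a} {c} a<N c<N = ≤-<-trans (∣m-n∣≤m⊔n a c) (⊔-pres-<m a<N c<N)

  cd-sym : ∀ a c → cd a c ≡ cd c a
  cd-sym a c rewrite ∣-∣-comm a c = refl

  cd-refl : ∀ a → cd a a ≡ 0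
  cd-refl a rewrite ∣n-n∣≡0 a = refl

  cd≡0⇒≡ : ∀ {a c} → a < N → c < N → cd a c ≡ 0 → a ≡ c
  cd≡0⇒≡ {a} {c} a<N c<N eq with ⊓-sel ∣ a - c ∣ (N ∸ ∣ a - c ∣)
  ... | inj₁ ⊓≡ = ∣m-n∣≡0⇒m≡n (trans (sym ⊓≡) eq)
  ... | inj₂ ⊓≡ = ⊥-elim (<⇒≱ (∣-∣<N a<N c<N) (m∸n≡0⇒m≤n (trans (sym ⊓≡) eq)))

  module _ {d M : ℕ} (d+M≡N : d + M ≡ N) (d≤M : d ≤ M) where

    private
      N∸d : N ∸ d ≡ M
      N∸d = trans (cong (_∸ d) (sym d+M≡N)) (m+n∸m≡n d M)
      N∸M : N ∸ M ≡ d
      N∸M = trans (cong (_∸ M) (sym d+M≡N)) (m+n∸n≡m d M)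

    cd≡⇐ : ∀ {a c} → ∣ a - c ∣ ≡ d ⊎ ∣ a - c ∣ ≡ M → cd a c ≡ d
    cd≡⇐ (inj₁ eq) = trans (cong (λ x → x ⊓ (N ∸ x)) eq) (trans (cong (d ⊓_) N∸d) (m≤n⇒m⊓n≡m d≤M))
    cd≡⇐ (inj₂ eq) = trans (cong (λ x → x ⊓ (N ∸ x)) eq) (trans (cong (M ⊓_) N∸M) (m≥n⇒m⊓n≡n d≤M))

    cd≡⇒ : ∀ {a c} → a < N → c < N → cd a c ≡ d → ∣ a - c ∣ ≡ d ⊎ ∣ a - c ∣ ≡ M
    cd≡⇒ {a} {c} a<N c<N eq with ⊓-sel ∣ a - c ∣ (N ∸ ∣ a - c ∣)
    ... | inj₁ ⊓≡ = inj₁ (trans (sym ⊓≡) eq)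
    ... | inj₂ ⊓≡ = inj₂ (trans (sym (m∸[m∸n]≡n (<⇒≤ (∣-∣<N a<N c<N))))
                               (trans (cong (N ∸_) (trans (sym ⊓≡) eq)) N∸d))

    -- If moreover 1 ≤ d < M, every point has exactly two points at cyclic
    -- distance d: one at distance d and one at distance M, each reached by
    -- going up or going down but not both.
    cd-count : 1 ≤ d → d ≢ M → ∀ a → a < N → ∑[ i < N ] χ (cd a (toℕ i) ≟ d) ≡ 2
    cd-count 1≤d d≢M a a<N = begin
      ∑[ i < N ] χ (cd a (toℕ i) ≟ d)
        ≡⟨ sum-cong-≗ {N} (λ i → χ-⊎ (cd≡⇒ a<N (toℕ<n i)) (cd≡⇐ {a} {toℕ i} ∘ inj₁) (cd≡⇐ {a} {toℕ i} ∘ inj₂)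
                                     (λ p q → d≢M (trans (sym p) q))
                                     (cd a (toℕ i) ≟ d) (∣ a - toℕ i ∣ ≟ d) (∣ a - toℕ i ∣ ≟ M)) ⟩
      ∑[ i < N ] (χ (∣ a - toℕ i ∣ ≟ d) + χ (∣ a - toℕ i ∣ ≟ M))
        ≡⟨ ∑-distrib-+ {N} (λ i → χ (∣ a - toℕ i ∣ ≟ d)) (λ i → χ (∣ a - toℕ i ∣ ≟ M)) ⟩
      ∑[ i < N ] χ (∣ a - toℕ i ∣ ≟ d) + ∑[ i < N ] χ (∣ a - toℕ i ∣ ≟ M)
        ≡⟨ cong₂ _+_ (∑-distance N a d 1≤d a<N) (∑-distance N a M (≤-trans 1≤d d≤M) a<N) ⟩
      (χ (a + d <? N) + χ (d ≤? a)) + (χ (a + M <? N) + χ (M ≤? a))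
        ≡⟨ solve 4 (λ x y z w → (x :+ y) :+ (z :+ w) := (x :+ w) :+ (y :+ z)) refl
                 (χ (a + d <? N)) (χ (d ≤? a)) (χ (a + M <? N)) (χ (M ≤? a)) ⟩
      (χ (a + d <? N) + χ (M ≤? a)) + (χ (d ≤? a) + χ (a + M <? N))
        ≡⟨ cong₂ _+_ (χ-compl up-excl up-cover (a + d <? N) (M ≤? a))
                     (χ-compl down-excl down-cover (d ≤? a) (a + M <? N)) ⟩
      2 ∎
      where
      open ≡-Reasoning
      N≡M+d : N ≡ M + d
      N≡M+d = trans (sym d+M≡N) (+-comm d M)
      up-excl : a + d < N → M ≤ a → ⊥
      up-excl a+d<N M≤a = <-irrefl refl (<-≤-trans a+d<N (subst (_≤ a + d) (sym N≡M+d) (+-monoˡ-≤ d M≤a)))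
      up-cover : ¬ (a + d < N) → M ≤ a
      up-cover a+d≮N = +-cancelʳ-≤ d M a (subst (_≤ a + d) N≡M+d (≮⇒≥ a+d≮N))
      down-excl : d ≤ a → a + M < N → ⊥
      down-excl d≤a a+M<N = <⇒≱ (+-cancelʳ-< M a d (subst (a + M <_) (sym d+M≡N) a+M<N)) d≤a
      down-cover : ¬ (d ≤ a) → a + M < N
      down-cover d≰a = subst (a + M <_) d+M≡N (+-monoˡ-< M (≰⇒> d≰a))

cycle-symmetric : ∀ N → Symmetric (Cycle N)
cycle-symmetric N u v uv = trans (cd-sym (toℕ v) (toℕ u)) uv
  where open CyclicDistance N

cycle-loopless : ∀ N → Loopless (Cycle N)
cycle-loopless N u v uv refl = 0≢1+n (trans (sym (cd-refl (toℕ u))) uv)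
  where open CyclicDistance N

cycle-regular : ∀ N → 3 ≤ N → Regular (Cycle N) 2
cycle-regular N@(suc (suc (suc j))) _ u =
  cd-count refl (s≤s z≤n) (s≤s z≤n) (λ ()) (toℕ u) (toℕ<n u)
  where open CyclicDistance N
cycle-regular (suc zero) (s≤s ())
cycle-regular (suc (suc zero)) (s≤s (s≤s ()))

module _ (G : Graph) where

  square-symmetric : Symmetric G → Symmetric (Square G)
  square-symmetric symmetric u v (u≢v , inj₁ uv) = u≢v ∘ sym , inj₁ (symmetric u v uv)
  square-symmetric symmetric u v (u≢v , inj₂ (w , uw , wv)) = u≢v ∘ sym , inj₂ (w , symmetric w v wv , symmetric u w uw)

  square-loopless : Loopless (Square G)
  square-loopless _ _ = proj₁

-- The square of the cycle C_N for N = 5 + k: two vertices are adjacent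
-- exactly when their cyclic distance is 1 or 2, so C_N² is 4-regular.
module SquareOfCycle (k : ℕ) where

  N : ℕ
  N = 5 + k

  open CyclicDistance N

  C² : Graph
  C² = Square (Cycle N)

  cd≡1⇐ : ∀ a c → ∣ a - c ∣ ≡ 1 ⊎ ∣ a - c ∣ ≡ 4 + k → cd a c ≡ 1
  cd≡1⇐ a c = cd≡⇐ {1} {4 + k} refl (s≤s z≤n) {a} {c}

  cd≡1⇒ : ∀ {a c} → a < N → c < N → cd a c ≡ 1 → ∣ a - c ∣ ≡ 1 ⊎ ∣ a - c ∣ ≡ 4 + k
  cd≡1⇒ = cd≡⇒ {1} {4 + k} refl (s≤s z≤n)

  cd≡2⇒ : ∀ {a c} → a < N → c < N → cd a c ≡ 2 → ∣ a - c ∣ ≡ 2 ⊎ ∣ a - c ∣ ≡ 3 + k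
  cd≡2⇒ = cd≡⇒ {2} {3 + k} refl (s≤s (s≤s z≤n))

  ends : ∀ {x y} → x < N → y < N → ∣ x - y ∣ ≡ 4 + k → (x ≡ 0 × y ≡ 4 + k) ⊎ (x ≡ 4 + k × y ≡ 0)
  ends {x} {y} x<N y<N eq = by-sides x y x<N y<N (∣-∣≡⇒ x y (4 + k) eq)
    where
    by-sides : ∀ x y → x < N → y < N → y ≡ x + (4 + k) ⊎ y + (4 + k) ≡ x →
               (x ≡ 0 × y ≡ 4 + k) ⊎ (x ≡ 4 + k × y ≡ 0)
    by-sides zero y _ _ (inj₁ y≡) = inj₁ (refl , y≡)
    by-sides (suc x) y _ y<N (inj₁ refl) = ⊥-elim (m+n≮n x (4 + k) (≤-pred y<N))
    by-sides x zero _ _ (inj₂ x≡) = inj₂ (sym x≡ , refl)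
    by-sides x (suc y) x<N _ (inj₂ refl) = ⊥-elim (m+n≮n y (4 + k) (≤-pred x<N))

  near-then-far : ∀ {a b c} → ∣ a - b ∣ ≡ 1 → ∣ b - c ∣ ≡ 4 + k → cd a c ≤ 2
  near-then-far {a} {b} {c} ab bc =
    ≤-trans (m⊓n≤n ∣ a - c ∣ (N ∸ ∣ a - c ∣)) (≤-trans (∸-monoʳ-≤ N far) (≤-reflexive (m+n∸n≡m 2 (3 + k))))
    where
    far : 3 + k ≤ ∣ a - c ∣
    far = ≤-pred (subst₂ _≤_ bc (cong (_+ ∣ a - c ∣) (trans (∣-∣-comm b a) ab)) (∣-∣-triangle b a c))

  far-then-far : ∀ {a b c} → a < N → b < N → c < N → ∣ a - b ∣ ≡ 4 + k → ∣ b - c ∣ ≡ 4 + k → a ≡ c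
  far-then-far a<N b<N c<N ab bc with ends a<N b<N ab | ends b<N c<N bc
  ... | inj₁ (a≡0 , _) | inj₂ (_ , c≡0) = trans a≡0 (sym c≡0)
  ... | inj₂ (a≡ , _) | inj₁ (_ , c≡) = trans a≡ (sym c≡)
  ... | inj₁ (_ , b≡) | inj₁ (b≡0 , _) = ⊥-elim (0≢1+n (trans (sym b≡0) b≡))
  ... | inj₂ (_ , b≡0) | inj₂ (b≡ , _) = ⊥-elim (0≢1+n (trans (sym b≡0) b≡))

  two-steps : ∀ {a b c} → a < N → b < N → c < N → cd a b ≡ 1 → cd b c ≡ 1 → a ≡ c ⊎ cd a c ≤ 2
  two-steps {a} {b} {c} a<N b<N c<N ab bc with cd≡1⇒ a<N b<N ab | cd≡1⇒ b<N c<N bc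
  ... | inj₁ ab′ | inj₁ bc′ = inj₂ (≤-trans (m⊓n≤m ∣ a - c ∣ (N ∸ ∣ a - c ∣))
                                           (subst (∣ a - c ∣ ≤_) (cong₂ _+_ ab′ bc′) (∣-∣-triangle a b c)))
  ... | inj₁ ab′ | inj₂ bc′ = inj₂ (near-then-far {a} {b} {c} ab′ bc′)
  ... | inj₂ ab′ | inj₁ bc′ = inj₂ (subst (_≤ 2) (cd-sym c a)
                                   (near-then-far {c} {b} {a} (trans (∣-∣-comm c b) bc′) (trans (∣-∣-comm b a) ab′)))
  ... | inj₂ ab′ | inj₂ bc′ = inj₁ (far-then-far a<N b<N c<N ab′ bc′)

  midpoint-above : ∀ a c → c < N → c ≡ a + 2 ⊎ c ≡ a + (3 + k) →
                   Σ[ w ∈ Fin N ] cd a (toℕ w) ≡ 1 × cd (toℕ w) c ≡ 1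
  midpoint-above a c c<N (inj₁ refl) = fromℕ< a+1<N , near-a , near-c
    where
    a+1<N : a + 1 < N
    a+1<N = <-trans (+-monoʳ-< a (n<1+n 1)) c<N
    near-a : cd a (toℕ (fromℕ< a+1<N)) ≡ 1
    near-a rewrite toℕ-fromℕ< a+1<N = cd≡1⇐ a (a + 1) (inj₁ (∣m-m+n∣≡n a 1))
    near-c : cd (toℕ (fromℕ< a+1<N)) (a + 2) ≡ 1
    near-c rewrite toℕ-fromℕ< a+1<N =
      cd≡1⇐ (a + 1) (a + 2) (inj₁ (∣-∣≡⇐ (a + 1) (a + 2) 1 (inj₁ (sym (+-assoc a 1 1)))))
  midpoint-above zero c c<N (inj₂ refl) = fromℕ (4 + k) , near-0 , near-c
    where
    near-0 : cd 0 (toℕ (fromℕ (4 + k))) ≡ 1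
    near-0 rewrite toℕ-fromℕ k = cd≡1⇐ 0 (4 + k) (inj₂ refl)
    near-c : cd (toℕ (fromℕ (4 + k))) (3 + k) ≡ 1
    near-c rewrite toℕ-fromℕ k = cd≡1⇐ (4 + k) (3 + k) (inj₁ (∣-∣≡⇐ (4 + k) (3 + k) 1 (inj₂ (+-comm (3 + k) 1))))
  midpoint-above (suc zero) c c<N (inj₂ refl) = fzero , cd≡1⇐ 1 0 (inj₁ refl) , cd≡1⇐ 0 (4 + k) (inj₂ refl)
  midpoint-above (suc (suc a)) c c<N (inj₂ refl) = ⊥-elim (m+n≮n a (3 + k) (≤-pred (≤-pred c<N)))

  -- the general case reduces to the previous one by symmetry
  midpoint : ∀ {a c} → a < N → c < N → cd a c ≡ 2 → Σ[ w ∈ Fin N ] cd a (toℕ w) ≡ 1 × cd (toℕ w) c ≡ 1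
  midpoint {a} {c} a<N c<N a~c = by-distance (cd≡2⇒ a<N c<N a~c)
    where
    Midpoint = Σ[ w ∈ Fin N ] cd a (toℕ w) ≡ 1 × cd (toℕ w) c ≡ 1
    by-side : ∀ {t} → c ≡ a + t ⊎ c + t ≡ a → (∀ {x y} → y ≡ x + t → y ≡ x + 2 ⊎ y ≡ x + (3 + k)) → Midpoint
    by-side (inj₁ above) shape = midpoint-above a c c<N (shape above)
    by-side (inj₂ below) shape with midpoint-above c a a<N (shape (sym below))
    ... | w , cw , wa = w , trans (cd-sym a (toℕ w)) wa , trans (cd-sym (toℕ w) c) cw
    by-distance : ∣ a - c ∣ ≡ 2 ⊎ ∣ a - c ∣ ≡ 3 + k → Midpoint
    by-distance (inj₁ d≡2) = by-side (∣-∣≡⇒ a c 2 d≡2) inj₁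
    by-distance (inj₂ d≡M) = by-side (∣-∣≡⇒ a c (3 + k) d≡M) inj₂

  square-adj⇒ : ∀ {u v} → Adj C² u v → cd (toℕ u) (toℕ v) ≡ 1 ⊎ cd (toℕ u) (toℕ v) ≡ 2
  square-adj⇒ (_ , inj₁ uv) = inj₁ uv
  square-adj⇒ {u} {v} (u≢v , inj₂ (w , uw , wv)) with two-steps (toℕ<n u) (toℕ<n w) (toℕ<n v) uw wv
  ... | inj₁ u≡v = ⊥-elim (u≢v (toℕ-injective u≡v))
  ... | inj₂ ≤2 = one-or-two ≤2 (u≢v ∘ toℕ-injective ∘ cd≡0⇒≡ (toℕ<n u) (toℕ<n v))
    where
    one-or-two : ∀ {x} → x ≤ 2 → x ≢ 0 → x ≡ 1 ⊎ x ≡ 2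
    one-or-two {zero} _ x≢0 = ⊥-elim (x≢0 refl)
    one-or-two {suc zero} _ _ = inj₁ refl
    one-or-two {suc (suc zero)} _ _ = inj₂ refl
    one-or-two {suc (suc (suc _))} (s≤s (s≤s ())) _

  square-adj⇐ : ∀ {u v} → cd (toℕ u) (toℕ v) ≡ 1 ⊎ cd (toℕ u) (toℕ v) ≡ 2 → Adj C² u v
  square-adj⇐ {u} {v} near = u≢v near , path near
    where
    u≢v : cd (toℕ u) (toℕ v) ≡ 1 ⊎ cd (toℕ u) (toℕ v) ≡ 2 → u ≢ v
    u≢v (inj₁ d≡1) refl = 0≢1+n (trans (sym (cd-refl (toℕ u))) d≡1)
    u≢v (inj₂ d≡2) refl = 0≢1+n (trans (sym (cd-refl (toℕ u))) d≡2)
    path : cd (toℕ u) (toℕ v) ≡ 1 ⊎ cd (toℕ u) (toℕ v) ≡ 2 →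
           Adj (Cycle N) u v ⊎ ∃[ w ] (Adj (Cycle N) u w × Adj (Cycle N) w v)
    path (inj₁ d≡1) = inj₁ d≡1
    path (inj₂ d≡2) = inj₂ (midpoint (toℕ<n u) (toℕ<n v) d≡2)

  -- Each vertex of C_N² has two neighbours at cyclic distance 1 and two at 2.
  square-regular : Regular C² 4
  square-regular u = begin
    ∑[ v < N ] adjχ C² u v
      ≡⟨ sum-cong-≗ {N} (λ v → χ-⊎ square-adj⇒ (square-adj⇐ ∘ inj₁) (square-adj⇐ ∘ inj₂)
                                   (λ d≡1 d≡2 → 1≢2 (trans (sym d≡1) d≡2))
                                   (Adj? C² u v) (cd (toℕ u) (toℕ v) ≟ 1) (cd (toℕ u) (toℕ v) ≟ 2)) ⟩
    ∑[ v < N ] (χ (cd (toℕ u) (toℕ v) ≟ 1) + χ (cd (toℕ u) (toℕ v) ≟ 2))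
      ≡⟨ ∑-distrib-+ {N} (λ v → χ (cd (toℕ u) (toℕ v) ≟ 1)) (λ v → χ (cd (toℕ u) (toℕ v) ≟ 2)) ⟩
    ∑[ v < N ] χ (cd (toℕ u) (toℕ v) ≟ 1) + ∑[ v < N ] χ (cd (toℕ u) (toℕ v) ≟ 2)
      ≡⟨ cong₂ _+_ (cd-count {1} {4 + k} refl (s≤s z≤n) (s≤s z≤n) (λ ()) (toℕ u) (toℕ<n u))
                   (cd-count {2} {3 + k} refl (s≤s (s≤s z≤n)) (s≤s z≤n) (λ ()) (toℕ u) (toℕ<n u)) ⟩
    4 ∎
    where
    open ≡-Reasoning
    1≢2 : 1 ≢ 2
    1≢2 ()

-- Powers of two: the exponents can be read off a power of two, and off a
-- sum of two distinct powers of two (its binary expansion).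
2^-injective : ∀ {a c} → 2 ^ a ≡ 2 ^ c → a ≡ c
2^-injective {a} {c} eq with <-cmp a c
... | tri< a<c _ _ = ⊥-elim (<-irrefl eq (^-monoʳ-< 2 (s≤s (s≤s z≤n)) a<c))
... | tri≈ _ a≡c _ = a≡c
... | tri> _ _ c<a = ⊥-elim (<-irrefl (sym eq) (^-monoʳ-< 2 (s≤s (s≤s z≤n)) c<a))

2^+2^<2^ : ∀ {a c c′} a′ → a < c → c < c′ → 2 ^ a + 2 ^ c < 2 ^ a′ + 2 ^ c′
2^+2^<2^ {a} {c} {c′} a′ a<c c<c′ = begin-strict
  2 ^ a + 2 ^ c          <⟨ +-monoˡ-< (2 ^ c) (^-monoʳ-< 2 (s≤s (s≤s z≤n)) a<c) ⟩
  2 ^ c + 2 ^ c          ≡⟨ cong (2 ^ c +_) (sym (+-identityʳ (2 ^ c))) ⟩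
  2 ^ suc c              ≤⟨ ^-monoʳ-≤ 2 c<c′ ⟩
  2 ^ c′                 ≤⟨ m≤n+m (2 ^ c′) (2 ^ a′) ⟩
  2 ^ a′ + 2 ^ c′        ∎
  where open ≤-Reasoning

2^-sorted-pair : ∀ {a c a′ c′} → a < c → a′ < c′ → 2 ^ a + 2 ^ c ≡ 2 ^ a′ + 2 ^ c′ → a ≡ a′ × c ≡ c′
2^-sorted-pair {a} {c} {a′} {c′} a<c a′<c′ eq with <-cmp c c′
... | tri< c<c′ _ _ = ⊥-elim (<-irrefl eq (2^+2^<2^ a′ a<c c<c′))
... | tri> _ _ c′<c = ⊥-elim (<-irrefl (sym eq) (2^+2^<2^ a a′<c′ c′<c))
... | tri≈ _ refl _ = 2^-injective (+-cancelʳ-≡ (2 ^ c) (2 ^ a) (2 ^ a′) eq) , refl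

2^-pair : ∀ {a c a′ c′} → a ≢ c → a′ ≢ c′ → 2 ^ a + 2 ^ c ≡ 2 ^ a′ + 2 ^ c′ →
          (a ≡ a′ × c ≡ c′) ⊎ (a ≡ c′ × c ≡ a′)
2^-pair {a} {c} {a′} {c′} a≢c a′≢c′ eq with <-cmp a c | <-cmp a′ c′
... | tri≈ _ a≡c _ | _ = ⊥-elim (a≢c a≡c)
... | _ | tri≈ _ a′≡c′ _ = ⊥-elim (a′≢c′ a′≡c′)
... | tri< a<c _ _ | tri< a′<c′ _ _ = inj₁ (2^-sorted-pair a<c a′<c′ eq)
... | tri< a<c _ _ | tri> _ _ c′<a′ = inj₂ (2^-sorted-pair a<c c′<a′ (trans eq (+-comm (2 ^ a′) (2 ^ c′))))
... | tri> _ _ c<a | tri< a′<c′ _ _ = inj₂ (swap (2^-sorted-pair c<a a′<c′ (trans (+-comm (2 ^ c) (2 ^ a)) eq)))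
... | tri> _ _ c<a | tri> _ _ c′<a′ =
  inj₁ (swap (2^-sorted-pair c<a c′<a′ (trans (+-comm (2 ^ c) (2 ^ a)) (trans eq (+-comm (2 ^ a′) (2 ^ c′))))))

-- The labels used in the construction: the pair {x, x + 1} or the
-- singleton {x}; x is always the least element.
pairOrSingleton : Bool → ℕ → FinSet
pairOrSingleton true x = x ∷ suc x ∷ []
pairOrSingleton false x = x ∷ []

least-∈ : ∀ b x → x ∈ pairOrSingleton b x
least-∈ true x = here refl
least-∈ false x = here refl

pairOrSingleton-nonempty : ∀ b x → pairOrSingleton b x ≢ []
pairOrSingleton-nonempty true x ()
pairOrSingleton-nonempty false x ()

least-≤ : ∀ b x {z} → z ∈ pairOrSingleton b x → x ≤ z
least-≤ true x (here refl) = ≤-refl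
least-≤ true x (there (here refl)) = n≤1+n x
least-≤ false x (here refl) = ≤-refl

card-pair : ∀ x → card (x ∷ suc x ∷ []) ≡ 2
card-pair x = ≤-antisym (card≤length (x ∷ suc x ∷ []))
                        (distinct⇒card≥2 {x ∷ suc x ∷ []} (here refl) (there (here refl)) (1+n≢n ∘ sym))
  where
  card≤length : ∀ A → card A ≤ length A
  card≤length A = unique⊆⇒length≤ (deduplicate-! A) (∈-deduplicate⁻ _≟_ A)

nonMono-pairOrSingleton : ∀ b x → χ (¬? (card (pairOrSingleton b x) ≟ 1)) ≡ ind b
nonMono-pairOrSingleton true x = χ-yes (λ c≡1 → 1+n≢n (trans (sym (card-pair x)) c≡1)) (¬? (card (x ∷ suc x ∷ []) ≟ 1))
nonMono-pairOrSingleton false x = refl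

pairOrSingleton-weak : ∀ b b′ x y → (b ≡ true → b′ ≡ true → ⊥) →
  card (pairOrSingleton b x ⊕ pairOrSingleton b′ y) ≡ card (pairOrSingleton b x) ⊔ card (pairOrSingleton b′ y)
pairOrSingleton-weak true true x y not-both = ⊥-elim (not-both refl refl)
pairOrSingleton-weak true false x y _ = trans (card-pair (x + y)) (cong (_⊔ 1) (sym (card-pair x)))
pairOrSingleton-weak false true x y _ =
  trans (cong (λ z → card (x + y ∷ z ∷ [])) (+-suc x y)) (trans (card-pair (x + y)) (cong (1 ⊔_) (sym (card-pair y))))
pairOrSingleton-weak false false x y _ = refl

same-least : ∀ {A B x y} → A ≈ˢ B →
             x ∈ A → (∀ {z} → z ∈ A → x ≤ z) → y ∈ B → (∀ {z} → z ∈ B → y ≤ z) → x ≡ y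
same-least {x = x} {y} A≈B x∈A x≤A y∈B y≤B =
  ≤-antisym (x≤A (Equivalence.from (A≈B y) y∈B)) (y≤B (Equivalence.to (A≈B x) x∈A))

-- Given an independent set S of a loopless graph H, label vertex u by
-- {2^u, 2^u + 1} if u ∈ S and by {2^u} otherwise.  The least elements
-- 2^u of the labels, and 2^u + 2^v of the edge labels, are pairwise
-- distinct, so this is a weak IASI whose non-mono vertices are exactly S.
module PowerLabelling (H : Graph) (loopless : Loopless H) (S : Fin (n H) → Bool)
  (independent : ∀ {u v} → S u ≡ true → S v ≡ true → ¬ Adj H u v) where

  base : Fin (n H) → ℕ
  base u = 2 ^ toℕ u

  label : Fin (n H) → FinSet
  label u = pairOrSingleton (S u) (base u)

  private
    base-least : ∀ u {z} → z ∈ label u → base u ≤ z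
    base-least u = least-≤ (S u) (base u)

    sum-∈ : ∀ u v → base u + base v ∈ label u ⊕ label v
    sum-∈ u v = ⊕⁺ (least-∈ (S u) (base u)) (least-∈ (S v) (base v))

    sum-least : ∀ u v {z} → z ∈ label u ⊕ label v → base u + base v ≤ z
    sum-least u v z∈ with ⊕⁻ {label u} {label v} z∈
    ... | a , b , a∈ , b∈ , refl = +-mono-≤ (base-least u a∈) (base-least v b∈)

    edge-injective : ∀ u v u′ v′ → Adj H u v → Adj H u′ v′ →
                     (label u ⊕ label v) ≈ˢ (label u′ ⊕ label v′) →
                     (u ≡ u′ × v ≡ v′) ⊎ (u ≡ v′ × v ≡ u′)
    edge-injective u v u′ v′ uv u′v′ same
      with 2^-pair (loopless u v uv ∘ toℕ-injective) (loopless u′ v′ u′v′ ∘ toℕ-injective)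
                   (same-least same (sum-∈ u v) (sum-least u v) (sum-∈ u′ v′) (sum-least u′ v′))
    ... | inj₁ (u≡ , v≡) = inj₁ (toℕ-injective u≡ , toℕ-injective v≡)
    ... | inj₂ (u≡ , v≡) = inj₂ (toℕ-injective u≡ , toℕ-injective v≡)

  label-weakIASI : IsWeakIASI H label
  label-weakIASI = record
    { iasi = record
      { nonempty = λ u → pairOrSingleton-nonempty (S u) (base u)
      ; injective = λ u v same → toℕ-injective (2^-injective
          (same-least same (least-∈ (S u) (base u)) (base-least u) (least-∈ (S v) (base v)) (base-least v)))
      ; edgeInj = edge-injective
      }
    ; weak = λ u v uv → pairOrSingleton-weak (S u) (S v) (base u) (base v) (λ su sv → independent su sv uv)
    }

  label-nonMono : nonMonoCount label ≡ ∑[ u < n H ] ind (S u)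
  label-nonMono = sum-cong-≗ {n H} (λ u → nonMono-pairOrSingleton (S u) (base u))

multipleOf3 : ℕ → Bool
multipleOf3 zero = true
multipleOf3 (suc zero) = false
multipleOf3 (suc (suc zero)) = false
multipleOf3 (suc (suc (suc a))) = multipleOf3 a

firstTriples : ℕ → ℕ → Bool
firstTriples q a = (a <ᵇ q * 3) ∧ multipleOf3 a

firstTriples⇒ : ∀ q a → firstTriples q a ≡ true → a < q * 3 × ∃[ s ] a ≡ s * 3
firstTriples⇒ q a chosen with a <ᵇ q * 3 in a<ᵇ
... | true = <ᵇ⇒< a (q * 3) (subst T (sym a<ᵇ) _) , multiple a chosen
  where
  multiple : ∀ a → multipleOf3 a ≡ true → ∃[ s ] a ≡ s * 3
  multiple zero _ = 0 , refl
  multiple (suc (suc (suc a))) m3 with multiple a m3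
  ... | s , refl = suc s , refl

firstTriples-count : ∀ q n → q * 3 ≤ n → ∑[ i < n ] ind (firstTriples q (toℕ i)) ≡ q
firstTriples-count zero n _ = ∑-zero n
firstTriples-count (suc q) (suc (suc (suc n))) (s≤s (s≤s (s≤s 3q≤n))) = cong suc (firstTriples-count q n 3q≤n)

module _ (k : ℕ) where
  open SquareOfCycle k
  open CyclicDistance N

  private
    C-regular : Regular (Cycle N) 2
    C-regular = cycle-regular N (s≤s (s≤s (s≤s z≤n)))

    C²-symmetric : Symmetric C²
    C²-symmetric = square-symmetric (Cycle N) (cycle-symmetric N)

    C²-loopless : Loopless C²
    C²-loopless = square-loopless (Cycle N)

  -- Distinct chosen points are at least 3 apart around C_N when 3q ≤ N,
  -- so they are pairwise non-adjacent in C_N².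
  firstTriples-independent : ∀ q → q * 3 ≤ N → ∀ {u v} →
    firstTriples q (toℕ u) ≡ true → firstTriples q (toℕ v) ≡ true → ¬ Adj C² u v
  firstTriples-independent q 3q≤N {u} {v} chosen-u chosen-v uv
    with firstTriples⇒ q (toℕ u) chosen-u | firstTriples⇒ q (toℕ v) chosen-v
  ... | a<3q , s , a≡ | c<3q , t , c≡ = excluded (square-adj⇒ uv)
    where
    a = toℕ u
    c = toℕ v
    m = ∣ s - t ∣
    gap : ∣ a - c ∣ ≡ m * 3
    gap = trans (cong₂ ∣_-_∣ a≡ c≡) (sym (*-distribʳ-∣-∣ 3 s t))
    m<q : m < q
    m<q = *-cancelʳ-< 3 m q (subst (_< q * 3) gap (≤-<-trans (∣m-n∣≤m⊔n a c) (⊔-pres-<m a<3q c<3q)))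
    not-far : m * 3 ≤ 2 + k
    not-far = +-cancelˡ-≤ 3 (m * 3) (2 + k) (≤-trans (*-monoˡ-≤ 3 m<q) 3q≤N)
    far : ∀ j → m * 3 ≢ j + (3 + k)
    far j eq = 1+n≰n (≤-trans (subst (3 + k ≤_) (sym eq) (m≤n+m (3 + k) j)) not-far)
    not-near : ∀ j → j * 3 ≢ 1 × j * 3 ≢ 2
    not-near zero = (λ ()) , (λ ())
    not-near (suc _) = (λ ()) , (λ ())
    excluded : cd a c ≡ 1 ⊎ cd a c ≡ 2 → ⊥
    excluded (inj₁ d≡1) with cd≡1⇒ (toℕ<n u) (toℕ<n v) d≡1
    ... | inj₁ ≡1 = proj₁ (not-near m) (trans (sym gap) ≡1)
    ... | inj₂ ≡N-1 = far 1 (trans (sym gap) ≡N-1)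
    excluded (inj₂ d≡2) with cd≡2⇒ (toℕ<n u) (toℕ<n v) d≡2
    ... | inj₁ ≡2 = proj₂ (not-near m) (trans (sym gap) ≡2)
    ... | inj₂ ≡N-2 = far 0 (trans (sym gap) ≡N-2)

  -- C_N² is 4-regular, hence has 2N edges.
  square-edgeCount : edgeCount C² ≡ N * 2
  square-edgeCount = *-cancelˡ-≡ (edgeCount C²) (N * 2) 2
    (trans (handshake C² C²-symmetric C²-loopless square-regular)
           (solve 1 (λ x → con 4 :* x := con 2 :* (x :* con 2)) refl N))

  weak-mono-count : ∀ {f} → IsWeakIASI C² f → monoEdges C² f + 4 * nonMonoCount f ≡ N * 2
  weak-mono-count W = trans (monoEdges+nonMono C² C²-symmetric C²-loopless square-regular W) square-edgeCount

  weak-nonMono-bound : ∀ {f} → IsWeakIASI C² f → nonMonoCount f ≤ N / 3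
  weak-nonMono-bound {f} W = subst (_≤ N / 3) (m*n/n≡m (nonMonoCount f) 3) (/-monoˡ-≤ 3 K*3≤N)
    where
    K*3≤N : nonMonoCount f * 3 ≤ N
    K*3≤N = packing (Cycle N) (cycle-symmetric N) (cycle-loopless N) C-regular (nonMono? f) (nonMono-independent W)

  -- Hence the sparing number of C_N² is 2N - 4 ⌊N/3⌋, attained by doubling
  -- the labels of the vertices 0, 3, …, 3(⌊N/3⌋ - 1).
  square-sparing : ∀ T → T + 4 * (N / 3) ≡ N * 2 → IsSparingNumber C² T
  square-sparing T T+4q≡2N = (label , label-weakIASI , attained) , lower-bound
    where
    q = N / 3
    open PowerLabelling C² C²-loopless (firstTriples q ∘ toℕ) (firstTriples-independent q (m/n*n≤m N 3))
    attained : monoEdges C² label ≡ T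
    attained = +-cancelʳ-≡ (4 * q) (monoEdges C² label) T (begin
      monoEdges C² label + 4 * q                ≡⟨ cong (λ K → monoEdges C² label + 4 * K) (sym chosen-count) ⟩
      monoEdges C² label + 4 * nonMonoCount label ≡⟨ weak-mono-count label-weakIASI ⟩
      N * 2                                     ≡⟨ sym T+4q≡2N ⟩
      T + 4 * q ∎)
      where
      open ≡-Reasoning
      chosen-count : nonMonoCount label ≡ q
      chosen-count = trans label-nonMono (firstTriples-count q N (m/n*n≤m N 3))
    lower-bound : ∀ g → IsWeakIASI C² g → T ≤ monoEdges C² g
    lower-bound g W = +-cancelʳ-≤ (4 * q) T (monoEdges C² g) (begin
      T + 4 * q                                ≡⟨ T+4q≡2N ⟩
      N * 2                                    ≡⟨ sym (weak-mono-count W) ⟩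
      monoEdges C² g + 4 * nonMonoCount g      ≤⟨ +-monoʳ-≤ (monoEdges C² g) (*-monoʳ-≤ 4 (weak-nonMono-bound W)) ⟩
      monoEdges C² g + 4 * q ∎)
      where open ≤-Reasoning

-- With r = N mod 3 the three closed forms of the theorem read
-- 2 (N + 2r) / 3 = 2 (⌊N/3⌋ + r) = 2N - 4 ⌊N/3⌋.
closed-form : ∀ N → (2 * (N + 2 * (N % 3))) / 3 + 4 * (N / 3) ≡ N * 2
closed-form N = begin
  (2 * (N + 2 * r)) / 3 + 4 * q   ≡⟨ cong (λ x → x / 3 + 4 * q) (trans (cong (λ x → 2 * (x + 2 * r)) N≡) (regroup q r)) ⟩
  ((q + r) * 2 * 3) / 3 + 4 * q   ≡⟨ cong (_+ 4 * q) (m*n/n≡m ((q + r) * 2) 3) ⟩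
  (q + r) * 2 + 4 * q             ≡⟨ collect q r ⟩
  (r + q * 3) * 2                 ≡⟨ cong (_* 2) (sym N≡) ⟩
  N * 2 ∎
  where
  open ≡-Reasoning
  q = N / 3
  r = N % 3
  N≡ : N ≡ r + q * 3
  N≡ = m≡m%n+[m/n]*n N 3
  regroup : ∀ q r → 2 * ((r + q * 3) + 2 * r) ≡ (q + r) * 2 * 3
  regroup = solve 2 (λ q r → con 2 :* ((r :+ q :* con 3) :+ con 2 :* r) := (q :+ r) :* con 2 :* con 3) refl
  collect : ∀ q r → (q + r) * 2 + 4 * q ≡ (r + q * 3) * 2
  collect = solve 2 (λ q r → (q :+ r) :* con 2 :+ con 4 :* q := (r :+ q :* con 3) :* con 2) refl

mainTheorem2 : (n : ℕ) → 5 ≤ n →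
    (n % 3 ≡ 0 → IsSparingNumber (Square (Cycle n)) ((2 * n) / 3)) ×
    (n % 3 ≡ 1 → IsSparingNumber (Square (Cycle n)) ((2 * (n + 2)) / 3)) ×
    (n % 3 ≡ 2 → IsSparingNumber (Square (Cycle n)) ((2 * (n + 4)) / 3))
mainTheorem2 (suc (suc (suc (suc (suc k))))) _ =
  square-sparing k _ ∘ value₀ , square-sparing k _ ∘ value , square-sparing k _ ∘ value
  where
  N = 5 + k
  value : ∀ {r} → N % 3 ≡ r → (2 * (N + 2 * r)) / 3 + 4 * (N / 3) ≡ N * 2
  value refl = closed-form N
  value₀ : N % 3 ≡ 0 → (2 * N) / 3 + 4 * (N / 3) ≡ N * 2
  value₀ r≡0 = subst (λ x → (2 * x) / 3 + 4 * (N / 3) ≡ N * 2) (+-identityʳ N) (value r≡0)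
mainTheorem2 (suc zero) (s≤s ())
mainTheorem2 (suc (suc zero)) (s≤s (s≤s ()))
mainTheorem2 (suc (suc (suc zero))) (s≤s (s≤s (s≤s ())))
mainTheorem2 (suc (suc (suc (suc zero)))) (s≤s (s≤s (s≤s (s≤s ()))))
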